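{- $$\lim_{n\to\infty}\frac{|CK_n|}{|K_n|}=1,$$ where $K_n$ and $CK_n$ are as defined in the context.
   Context: For $n\ge1$, $K_n$ is the set of king permutations: permutations $\sigma=[\sigma_1,\dots,\sigma_n]\in S_n$ (one-line notation) with $|\sigma_i-\sigma_{i+1}|>1$ for all $1\le i\le n-1$ (it is nonempty for $n\ge4$). $CK_n$ is the set of cylindrical king permutations: those $\sigma\in K_n$ that additionally satisfy $|\sigma_1-\sigma_n|>1$. -}

module Defs where

open import Data.Nat using (ℕ; zero; suc; _<_; _≤_; ∣_-_∣; _≟_)
open import Data.Nat.Properties using (_<?_; _≤?_)
open import Data.List using (List; []; _∷_; [_]; map; concatMap; applyUpTo; filter; length; last)
open import Data.List.Relation.Unary.All using (All; all?)
open import Data.List.Relation.Unary.Unique.Propositional using (Unique)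
open import Data.List.Relation.Unary.Unique.DecPropositional _≟_ using (unique?)
open import Data.Maybe using (Maybe; just; nothing)
open import Data.Product using (_×_; _,_)
open import Data.Unit using (⊤; tt)
open import Data.Integer using (+_)
open import Data.Rational using (ℚ; 0ℚ; _/_)
open import Relation.Nullary using (Dec; yes; no; _×-dec_)
open import Relation.Unary using (Decidable)
open import Relation.Binary.PropositionalEquality using (_≡_)

-- A permutation σ ∈ S_n in one-line notation [σ₁,…,σₙ] is a list of
-- length n whose entries lie in {1,…,n} and are pairwise distinct.
IsPerm : ℕ → List ℕ → Set
IsPerm n σ = (length σ ≡ n) × All (λ x → 1 ≤ x × x ≤ n) σ × Unique σ

KingAdj : List ℕ → Set
KingAdj []           = ⊤
KingAdj (x ∷ [])     = ⊤
KingAdj (x ∷ y ∷ σ)  = (1 < ∣ x - y ∣) × KingAdj (y ∷ σ)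

WrapAdj : List ℕ → Set
WrapAdj []      = ⊤
WrapAdj (x ∷ σ) with last (x ∷ σ)
... | just y  = 1 < ∣ x - y ∣
... | nothing = ⊤

IsKing : ℕ → List ℕ → Set
IsKing n σ = IsPerm n σ × KingAdj σ

IsCylKing : ℕ → List ℕ → Set
IsCylKing n σ = IsKing n σ × WrapAdj σ

kingAdj? : Decidable KingAdj
kingAdj? []          = yes tt
kingAdj? (x ∷ [])    = yes tt
kingAdj? (x ∷ y ∷ σ) = (1 <? ∣ x - y ∣) ×-dec kingAdj? (y ∷ σ)

wrapAdj? : Decidable WrapAdj
wrapAdj? []      = yes tt
wrapAdj? (x ∷ σ) with last (x ∷ σ)
... | just y  = 1 <? ∣ x - y ∣
... | nothing = yes tt

isPerm? : ∀ n → Decidable (IsPerm n)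
isPerm? n σ = (length σ ≟ n) ×-dec (all? (λ x → (1 ≤? x) ×-dec (x ≤? n)) σ ×-dec unique? σ)

isKing? : ∀ n → Decidable (IsKing n)
isKing? n σ = isPerm? n σ ×-dec kingAdj? σ

isCylKing? : ∀ n → Decidable (IsCylKing n)
isCylKing? n σ = isKing? n σ ×-dec wrapAdj? σ

words : ℕ → ℕ → List (List ℕ)
words zero    n = [ [] ]
words (suc k) n = concatMap (λ x → map (x ∷_) (words k n)) (applyUpTo suc n)

#K : ℕ → ℕ
#K n = length (filter (isKing? n) (words n n))

#CK : ℕ → ℕ
#CK n = length (filter (isCylKing? n) (words n n))

-- the ratio |CK_n| / |K_n| as a rational (set to 0 when K_n = ∅, i.e. n = 2,3;
-- this convention is irrelevant for the limit)
ratio : ℕ → ℚ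
ratio n with #K n
... | zero  = 0ℚ
... | suc k = (+ #CK n) / suc k

-- A king permutation σ = x ∷ ρ that is not cylindrical has x within 1 of the last entry of ρ.
-- Moving x into one of the n − 2 interior gaps of ρ gives a king permutation unless a
-- neighbour of the gap is within 1 of x; at most two entries of ρ are, each bordering at most
-- two gaps, so σ yields at least n − 6 king permutations τ.  Conversely τ determines σ up to
-- two choices: x is within 1 of the last entry of τ, and ρ is τ with x deleted.  Double
-- counting gives |K_n ∖ CK_n| (n − 6) ≤ 2 |K_n|, hence |CK_n| / |K_n| ≥ 1 − 2 / (n − 6).
module Submission where

open import Defs

open import Level using (Level)
open import Data.Nat as ℕ using (ℕ; zero; suc; _+_; _*_; _∸_; _≤_; z≤n; s≤s; _≟_)
open import Data.Nat.Properties
import Data.Nat.Solver as ℕ-Solver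
open import Data.Nat.Coprimality using (Coprime)
open import Algebra.Properties.CommutativeSemigroup *-commutativeSemigroup using (x∙yz≈y∙xz)
import Data.Integer as ℤ
import Data.Integer.Properties as ℤ
import Data.Integer.Solver as ℤ-Solver
open import Data.Rational as ℚ using (ℚ; mkℚ; 0ℚ; 1ℚ; _-_; _<_; ∣_∣; toℚᵘ)
import Data.Rational.Properties as ℚ
open import Data.Rational.Unnormalised as ℚᵘ using (mkℚᵘ; *≡*; *<*)
import Data.Rational.Unnormalised.Properties as ℚᵘ
open import Data.List
  using (List; []; _∷_; [_]; _++_; map; filter; length; concatMap; applyUpTo; cartesianProductWith; last)
open import Data.List.Properties
  using ( length-++; length-map; filter-++; filter-none; filter-accept; filter-reject; filter-all
        ; length-filter; filter-some; ∷-injective; ∷-injectiveʳ; ≡-dec)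
open import Data.List.Membership.Propositional using (_∈_; _∉_; find; lose)
open import Data.List.Membership.Propositional.Properties
  using (∈-filter⁺; ∈-filter⁻; ∈-map⁺; ∈-map⁻; ∈-concatMap⁻; ∈-cartesianProductWith⁺; ∈-applyUpTo⁺)
import Data.List.Membership.DecPropositional as DecMembership
open import Data.List.Relation.Unary.Any using (here; there)
open import Data.List.Relation.Unary.All as All using (All; []; _∷_)
open import Data.List.Relation.Unary.All.Properties using (¬Any⇒All¬; All¬⇒¬Any)
open import Data.List.Relation.Unary.AllPairs using ([]; _∷_)
open import Data.List.Relation.Unary.Unique.Propositional using (Unique)
import Data.List.Relation.Unary.Unique.Propositional.Properties as Unique
import Data.List.Relation.Binary.Sublist.Propositional.Properties as Sublist
open import Data.List.Relation.Binary.Permutation.Propositional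
  using (_↭_; prep; swap; ↭-refl; ↭-trans; ↭-sym; ↭⇒↭ₛ)
open import Data.List.Relation.Binary.Permutation.Propositional.Properties using (↭-length; All-resp-↭)
import Data.List.Relation.Binary.Permutation.Setoid.Properties as SetoidPermutation
open import Data.Maybe using (just; nothing)
open import Data.Product using (∃; ∃-syntax; _×_; _,_; proj₁; proj₂)
open import Data.Unit using (tt)
open import Function using (_∘_; id)
open import Relation.Nullary using (¬_; yes; no; ¬?; _×-dec_; contradiction)
open import Relation.Nullary.Decidable using (toWitness; decidable-stable)
open import Relation.Unary using (Pred; Decidable)
open import Relation.Binary.Definitions using (DecidableEquality)
open import Relation.Binary.PropositionalEquality
  using (_≡_; _≢_; refl; sym; trans; cong; cong₂; subst; subst₂; setoid; module ≡-Reasoning)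

private variable
  ℓ p q : Level
  A B C : Set ℓ

count : {P : Pred A p} → Decidable P → List A → ℕ
count P? xs = length (filter P? xs)

module _ {P : Pred A p} (P? : Decidable P) where

  count-++ : ∀ xs ys → count P? (xs ++ ys) ≡ count P? xs + count P? ys
  count-++ xs ys = trans (cong length (filter-++ P? xs ys)) (length-++ (filter P? xs))

  count-[x]≡1 : ∀ {x} → P x → count P? [ x ] ≡ 1
  count-[x]≡1 px = cong length (filter-accept P? {xs = []} px)

  count-[x]≡0 : ∀ {x} → ¬ P x → count P? [ x ] ≡ 0
  count-[x]≡0 ¬px = cong length (filter-reject P? {xs = []} ¬px)

  count-split : ∀ xs → count P? xs + count (¬? ∘ P?) xs ≡ length xs
  count-split []       = refl
  count-split (x ∷ xs) with P? x
  ... | yes _ = cong suc (count-split xs)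
  ... | no  _ = trans (+-suc _ _) (cong suc (count-split xs))

  count-× : {Q : Pred A q} (Q? : Decidable Q) → ∀ xs →
            count P? xs ≡ count (λ x → P? x ×-dec Q? x) xs + count (λ x → P? x ×-dec ¬? (Q? x)) xs
  count-× Q? []       = refl
  count-× Q? (x ∷ xs) with P? x | Q? x
  ... | yes _ | yes _ = cong suc (count-× Q? xs)
  ... | yes _ | no  _ = trans (cong suc (count-× Q? xs)) (sym (+-suc _ _))
  ... | no  _ | yes _ = count-× Q? xs
  ... | no  _ | no  _ = count-× Q? xs

  count-filter-≤ : {Q : Pred A q} (Q? : Decidable Q) → ∀ xs → count P? (filter Q? xs) ≤ count P? xs
  count-filter-≤ Q? xs =
    Sublist.length-mono-≤ (Sublist.filter⁺ P? P? (λ { refl → id }) (Sublist.filter-⊆ Q? xs))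

  count-map-≤ : {Q : Pred B q} (Q? : Decidable Q) (f : B → A) → ∀ xs →
                (∀ {x} → x ∈ xs → P (f x) → Q x) → count P? (map f xs) ≤ count Q? xs
  count-map-≤ Q? f []       _ = z≤n
  count-map-≤ Q? f (x ∷ xs) h with P? (f x) | Q? x
  ... | yes _  | yes _ = s≤s (count-map-≤ Q? f xs (h ∘ there))
  ... | yes pf | no ¬q = contradiction (h (here refl) pf) ¬q
  ... | no  _  | yes _ = m≤n⇒m≤1+n (count-map-≤ Q? f xs (h ∘ there))
  ... | no  _  | no  _ = count-map-≤ Q? f xs (h ∘ there)

  count-concatMap-≤ : {Q : Pred B q} (Q? : Decidable Q) (f : B → List A) → ∀ xs →
                      (∀ {x} → x ∈ xs → count P? (f x) ≤ 1) →
                      (∀ {x y} → x ∈ xs → y ∈ f x → P y → Q x) →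
                      count P? (concatMap f xs) ≤ count Q? xs
  count-concatMap-≤ Q? f []       _    _    = z≤n
  count-concatMap-≤ Q? f (x ∷ xs) once only rewrite count-++ (f x) (concatMap f xs) with Q? x
  ... | yes _ = +-mono-≤ (once (here refl)) (count-concatMap-≤ Q? f xs (once ∘ there) (only ∘ there))
  ... | no ¬q rewrite filter-none P? (All.tabulate (λ y∈ py → ¬q (only (here refl) y∈ py))) =
    count-concatMap-≤ Q? f xs (once ∘ there) (only ∘ there)

module _ (_≟ᴬ_ : DecidableEquality A) where

  count-Unique : ∀ y {xs} → Unique xs → count (y ≟ᴬ_) xs ≤ 1
  count-Unique y {[]}     _          = z≤n
  count-Unique y {x ∷ xs} (x∉xs ∷ u) with y ≟ᴬ x
  ... | no  _    = count-Unique y u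
  ... | yes refl rewrite filter-none (y ≟ᴬ_) x∉xs = s≤s z≤n

  length-≤-*-length : ∀ c ps ks → (∀ {p} → p ∈ ps → p ∈ ks) →
                      (∀ k → count (k ≟ᴬ_) ps ≤ c) → length ps ≤ c * length ks
  length-≤-*-length c []       ks       _  _    = z≤n
  length-≤-*-length c (p ∷ ps) []       ⊆ _    with () ← ⊆ (here refl)
  length-≤-*-length c ps       (k ∷ ks) ⊆ mult = begin
    length ps                    ≡⟨ count-split (k ≟ᴬ_) ps ⟨
    count (k ≟ᴬ_) ps + length ps′ ≤⟨ +-mono-≤ (mult k) (length-≤-*-length c ps′ ks ⊆′ mult′) ⟩
    c + c * length ks            ≡⟨ *-suc c (length ks) ⟨
    c * length (k ∷ ks)          ∎
    where
    open ≤-Reasoning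
    ps′ = filter (¬? ∘ (k ≟ᴬ_)) ps
    ⊆′ : ∀ {p} → p ∈ ps′ → p ∈ ks
    ⊆′ p∈ps′ with p∈ps , k≢p ← ∈-filter⁻ (¬? ∘ (k ≟ᴬ_)) p∈ps′ | ⊆ p∈ps
    ... | here p≡k   = contradiction (sym p≡k) k≢p
    ... | there p∈ks = p∈ks
    mult′ : ∀ k′ → count (k′ ≟ᴬ_) ps′ ≤ c
    mult′ k′ = ≤-trans (count-filter-≤ (k′ ≟ᴬ_) (¬? ∘ (k ≟ᴬ_)) ps) (mult k′)

  Unique⇒length≤ : ∀ {ps} ks → Unique ps → (∀ {p} → p ∈ ps → p ∈ ks) → length ps ≤ length ks
  Unique⇒length≤ {ps} ks u ⊆ =
    ≤-trans (length-≤-*-length 1 ps ks ⊆ (λ k → count-Unique k u))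
            (≤-reflexive (*-identityˡ (length ks)))

length-concatMap-≥ : (f : A → List B) (m : ℕ) → ∀ xs →
                     (∀ {x} → x ∈ xs → m ≤ length (f x)) → length xs * m ≤ length (concatMap f xs)
length-concatMap-≥ f m []       _ = z≤n
length-concatMap-≥ f m (x ∷ xs) h =
  ≤-trans (+-mono-≤ (h (here refl)) (length-concatMap-≥ f m xs (h ∘ there)))
          (≤-reflexive (sym (length-++ (f x))))

concatMap-map≡cartesianProductWith : (f : A → B → C) → ∀ xs ys →
  concatMap (λ x → map (f x) ys) xs ≡ cartesianProductWith f xs ys
concatMap-map≡cartesianProductWith f []       ys = refl
concatMap-map≡cartesianProductWith f (x ∷ xs) ys =
  cong (map (f x) ys ++_) (concatMap-map≡cartesianProductWith f xs ys)

words-suc : ∀ k n → words (suc k) n ≡ cartesianProductWith _∷_ (applyUpTo suc n) (words k n)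
words-suc k n = concatMap-map≡cartesianProductWith _∷_ (applyUpTo suc n) (words k n)

∈-words : ∀ {n} σ → All (λ x → 1 ≤ x × x ≤ n) σ → σ ∈ words (length σ) n
∈-words []          []                          = here refl
∈-words {n} (suc x ∷ σ) ((s≤s z≤n , x<n) ∷ bounds) =
  subst (_ ∈_) (sym (words-suc (length σ) n))
        (∈-cartesianProductWith⁺ _∷_ (∈-applyUpTo⁺ suc x<n) (∈-words σ bounds))

words-unique : ∀ k n → Unique (words k n)
words-unique zero    n = [] ∷ []
words-unique (suc k) n = subst Unique (sym (words-suc k n))
  (Unique.cartesianProductWith⁺ _∷_ ∷-injective
    (Unique.applyUpTo⁺₁ suc n (λ i<j _ → <⇒≢ i<j ∘ suc-injective)) (words-unique k n))

IsPerm⇒∈words : ∀ {n σ} → IsPerm n σ → σ ∈ words n n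
IsPerm⇒∈words {σ = σ} (refl , bounds , _) = ∈-words σ bounds

IsPerm-resp-↭ : ∀ {n σ τ} → σ ↭ τ → IsPerm n σ → IsPerm n τ
IsPerm-resp-↭ σ↭τ (len , bounds , u) =
  trans (sym (↭-length σ↭τ)) len ,
  All-resp-↭ σ↭τ bounds ,
  SetoidPermutation.Unique-resp-↭ (setoid ℕ) (↭⇒↭ₛ σ↭τ) u

IsPerm-∷-suc : ∀ {m τ} → IsPerm m τ → IsPerm (suc m) (suc m ∷ τ)
IsPerm-∷-suc (len , bounds , u) =
  cong suc len ,
  (s≤s z≤n , ≤-refl) ∷ All.map (λ (1≤y , y≤m) → 1≤y , m≤n⇒m≤1+n y≤m) bounds ,
  All.map (λ (_ , y≤m) → <⇒≢ (s≤s y≤m) ∘ sym) bounds ∷ u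

-- Insertion into interior gaps

module _ {A : Set ℓ} where

  gaps : A → List A → List (List A)
  gaps x []          = []
  gaps x (a ∷ [])    = []
  gaps x (a ∷ b ∷ l) = (a ∷ x ∷ b ∷ l) ∷ map (a ∷_) (gaps x (b ∷ l))

  data Insertion (x : A) : List A → List A → Set ℓ where
    here  : ∀ a b l → Insertion x (a ∷ b ∷ l) (a ∷ x ∷ b ∷ l)
    there : ∀ a {ρ τ} → Insertion x ρ τ → Insertion x (a ∷ ρ) (a ∷ τ)

  ∈-gaps⇒Insertion : ∀ {x τ} ρ → τ ∈ gaps x ρ → Insertion x ρ τ
  ∈-gaps⇒Insertion (a ∷ b ∷ l) (here refl) = here a b l
  ∈-gaps⇒Insertion (a ∷ b ∷ l) (there τ∈) with τ′ , τ′∈ , refl ← ∈-map⁻ (a ∷_) τ∈ =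
    there a (∈-gaps⇒Insertion (b ∷ l) τ′∈)

  Insertion⇒↭ : ∀ {x ρ τ} → Insertion x ρ τ → τ ↭ x ∷ ρ
  Insertion⇒↭ (here a b l) = swap a _ ↭-refl
  Insertion⇒↭ (there a i)  = ↭-trans (prep a (Insertion⇒↭ i)) (swap a _ ↭-refl)

  Insertion-head : ∀ {x b l τ} → Insertion x (b ∷ l) τ → ∃ λ τ′ → τ ≡ b ∷ τ′
  Insertion-head (here _ _ _) = _ , refl
  Insertion-head (there _ _)  = _ , refl

  Insertion-last : ∀ {x ρ τ} → Insertion x ρ τ → last τ ≡ last ρ
  Insertion-last (here _ _ _)            = refl
  Insertion-last (there _ (here _ _ _))  = refl
  Insertion-last (there _ i@(there _ _)) = Insertion-last i

  length-gaps : ∀ x ρ → length (gaps x ρ) ≡ length ρ ∸ 1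
  length-gaps x []          = refl
  length-gaps x (a ∷ [])    = refl
  length-gaps x (a ∷ b ∷ l) =
    cong suc (trans (length-map (a ∷_) (gaps x (b ∷ l))) (length-gaps x (b ∷ l)))

  module _ (_≟ᴬ_ : DecidableEquality A) where

    remove : A → List A → List A
    remove x = filter (λ y → ¬? (x ≟ᴬ y))

    remove-∷ : ∀ x ρ → remove x (x ∷ ρ) ≡ remove x ρ
    remove-∷ x ρ = filter-reject (λ y → ¬? (x ≟ᴬ y)) (λ x≢x → x≢x refl)

    remove-∉ : ∀ {x} ρ → x ∉ ρ → remove x ρ ≡ ρ
    remove-∉ ρ x∉ρ = filter-all _ (¬Any⇒All¬ ρ x∉ρ)

    Insertion-remove : ∀ {x ρ τ} → Insertion x ρ τ → remove x τ ≡ remove x ρ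
    Insertion-remove {x} (here a b l) with x ≟ᴬ a
    ... | yes _ = remove-∷ x (b ∷ l)
    ... | no  _ = cong (a ∷_) (remove-∷ x (b ∷ l))
    Insertion-remove {x} (there a i) with x ≟ᴬ a
    ... | yes _ = Insertion-remove i
    ... | no  _ = cong (a ∷_) (Insertion-remove i)

    gaps-unique : ∀ x ρ → x ∉ ρ → Unique (gaps x ρ)
    gaps-unique x []          _   = []
    gaps-unique x (a ∷ [])    _   = []
    gaps-unique x (a ∷ b ∷ l) x∉ρ =
      All.tabulate fresh ∷ Unique.map⁺ ∷-injectiveʳ (gaps-unique x (b ∷ l) (x∉ρ ∘ there))
      where
      fresh : ∀ {τ} → τ ∈ map (a ∷_) (gaps x (b ∷ l)) → a ∷ x ∷ b ∷ l ≢ τ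
      fresh τ∈ eq with τ′ , τ′∈ , refl ← ∈-map⁻ (a ∷_) τ∈
                  with _ , refl ← Insertion-head (∈-gaps⇒Insertion (b ∷ l) τ′∈)
                  with refl ← eq = x∉ρ (there (here refl))

-- Spoiled gaps

Near : ℕ → ℕ → Set
Near x y = ¬ 1 ℕ.< ℕ.∣ x - y ∣

near? : ∀ x → Decidable (Near x)
near? x y = ¬? (1 ℕ.<? ℕ.∣ x - y ∣)

neighbours : ℕ → List ℕ
neighbours y = suc y ∷ y ∸ 1 ∷ []

Near⇒∈neighbours : ∀ x y → Near x y → x ≢ y → x ∈ neighbours y
Near⇒∈neighbours zero          zero          _    x≢y = contradiction refl x≢y
Near⇒∈neighbours zero          (suc zero)    _    _   = there (here refl)
Near⇒∈neighbours zero          (suc (suc y)) near _   = contradiction (s≤s (s≤s z≤n)) near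
Near⇒∈neighbours (suc zero)    zero          _    _   = here refl
Near⇒∈neighbours (suc (suc x)) zero          near _   = contradiction (s≤s (s≤s z≤n)) near
Near⇒∈neighbours (suc x)       (suc zero)    near x≢y with Near⇒∈neighbours x zero near (x≢y ∘ cong suc)
... | here x≡1           = here (cong suc x≡1)
... | there (here refl)  = contradiction refl x≢y
Near⇒∈neighbours (suc x)       (suc (suc y)) near x≢y with Near⇒∈neighbours x (suc y) near (x≢y ∘ cong suc)
... | here x≡2+y         = here (cong suc x≡2+y)
... | there (here x≡y)   = there (here (cong suc x≡y))

count-Near≤2 : ∀ x ρ → Unique (x ∷ ρ) → count (near? x) ρ ≤ 2
count-Near≤2 x ρ (x∉ρ ∷ u) =
  Unique⇒length≤ _≟_ (neighbours x) (Unique.filter⁺ (near? x) u) near⇒neighbour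
  where
  near⇒neighbour : ∀ {y} → y ∈ filter (near? x) ρ → y ∈ neighbours x
  near⇒neighbour y∈ with y∈ρ , near ← ∈-filter⁻ (near? x) y∈ =
    Near⇒∈neighbours _ x (near ∘ subst (1 ℕ.<_) (∣-∣-comm _ x)) (All.lookup x∉ρ y∈ρ ∘ sym)

notKing? : Decidable (¬_ ∘ KingAdj)
notKing? = ¬? ∘ kingAdj?

spoiled-gap : ∀ x a b l → KingAdj (b ∷ l) →
              count notKing? [ a ∷ x ∷ b ∷ l ] ≤ count (near? x) [ a ] + count (near? x) [ b ]
spoiled-gap x a b l king with near? x a | near? x b
... | yes xa | _      = ≤-trans (length-filter notKing? [ a ∷ x ∷ b ∷ l ])
                               (≤-trans (≤-reflexive (sym (count-[x]≡1 (near? x) xa))) (m≤m+n _ _))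
... | no _   | yes xb = ≤-trans (length-filter notKing? [ a ∷ x ∷ b ∷ l ])
                               (≤-trans (≤-reflexive (sym (count-[x]≡1 (near? x) xb))) (m≤n+m _ _))
... | no ¬xa | no ¬xb =
  ≤-trans (≤-reflexive (count-[x]≡0 notKing? {a ∷ x ∷ b ∷ l} (λ ¬king → ¬king king′))) z≤n
  where
  king′ : KingAdj (a ∷ x ∷ b ∷ l)
  king′ = subst (1 ℕ.<_) (∣-∣-comm x a) (decidable-stable (1 ℕ.<? _) ¬xa) ,
          decidable-stable (1 ℕ.<? _) ¬xb , king

spoiled-gaps : ∀ x a l → KingAdj (a ∷ l) →
               count notKing? (gaps x (a ∷ l)) ≤ count (near? x) (a ∷ l) + count (near? x) l
spoiled-gaps x a []      _            = z≤n
spoiled-gaps x a (b ∷ l) (ab , king) = begin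
  count notKing? (gaps x (a ∷ b ∷ l))
    ≡⟨ count-++ notKing? [ a ∷ x ∷ b ∷ l ] (map (a ∷_) G) ⟩
  count notKing? [ a ∷ x ∷ b ∷ l ] + count notKing? (map (a ∷_) G)
    ≤⟨ +-mono-≤ (spoiled-gap x a b l king)
                (≤-trans (count-map-≤ notKing? notKing? (a ∷_) G extend) (spoiled-gaps x b l king)) ⟩
  (#a + #b) + (#bl + #l)
    ≡⟨ regroup #a #b #l #bl (count-++ (near? x) [ b ] l) ⟩
  (#a + #bl) + #bl
    ≡⟨ cong (_+ #bl) (count-++ (near? x) [ a ] (b ∷ l)) ⟨
  count (near? x) (a ∷ b ∷ l) + #bl ∎
  where
  open ≤-Reasoning
  G   = gaps x (b ∷ l)
  #a  = count (near? x) [ a ]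
  #b  = count (near? x) [ b ]
  #l  = count (near? x) l
  #bl = count (near? x) (b ∷ l)
  regroup : ∀ m n k s → s ≡ n + k → (m + n) + (s + k) ≡ (m + s) + s
  regroup m n k _ refl =
    solve 3 (λ m n k → (m :+ n) :+ ((n :+ k) :+ k) := (m :+ (n :+ k)) :+ (n :+ k)) refl m n k
    where open ℕ-Solver.+-*-Solver using (solve; _:+_; _:=_)
  extend : ∀ {τ} → τ ∈ G → ¬ KingAdj (a ∷ τ) → ¬ KingAdj τ
  extend τ∈ ¬king king′ with _ , refl ← Insertion-head (∈-gaps⇒Insertion (b ∷ l) τ∈) =
    ¬king (ab , king′)

count-spoiled≤4 : ∀ x ρ → Unique (x ∷ ρ) → KingAdj ρ → count notKing? (gaps x ρ) ≤ 4
count-spoiled≤4 x []      _                                 _    = z≤n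
count-spoiled≤4 x (a ∷ l) u@((_ ∷ x∉l) ∷ (_ ∷ l-unique)) king =
  ≤-trans (spoiled-gaps x a l king)
          (+-mono-≤ (count-Near≤2 x (a ∷ l) u) (count-Near≤2 x l (x∉l ∷ l-unique)))

count-good-gaps : ∀ x ρ → Unique (x ∷ ρ) → KingAdj ρ → length ρ ∸ 5 ≤ count kingAdj? (gaps x ρ)
count-good-gaps x ρ u king = begin
  length ρ ∸ 5      ≡⟨ ∸-+-assoc (length ρ) 1 4 ⟨
  length ρ ∸ 1 ∸ 4  ≡⟨ cong (_∸ 4) (trans (sym (length-gaps x ρ)) (sym (count-split kingAdj? G))) ⟩
  good + bad ∸ 4    ≤⟨ ∸-monoʳ-≤ (good + bad) (count-spoiled≤4 x ρ u king) ⟩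
  good + bad ∸ bad  ≡⟨ m+n∸n≡m good bad ⟩
  good              ∎
  where
  open ≤-Reasoning
  G    = gaps x ρ
  good = count kingAdj? G
  bad  = count notKing? G

extensions : List ℕ → List (List ℕ)
extensions []      = []
extensions (x ∷ ρ) = filter kingAdj? (gaps x ρ)

KingAdj-tail : ∀ {x ρ} → KingAdj (x ∷ ρ) → KingAdj ρ
KingAdj-tail {ρ = []}    _          = tt
KingAdj-tail {ρ = _ ∷ _} (_ , king) = king

∈-extensions⇒IsKing : ∀ {n σ τ} → IsPerm n σ → τ ∈ extensions σ → IsKing n τ
∈-extensions⇒IsKing {σ = x ∷ ρ} perm τ∈ with τ∈gaps , king ← ∈-filter⁻ kingAdj? τ∈ =
  IsPerm-resp-↭ (↭-sym (Insertion⇒↭ (∈-gaps⇒Insertion ρ τ∈gaps))) perm , king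

length-extensions : ∀ {n x ρ} → IsPerm n (x ∷ ρ) → KingAdj ρ → n ∸ 6 ≤ length (extensions (x ∷ ρ))
length-extensions {x = x} {ρ} (refl , _ , unique) king = count-good-gaps x ρ unique king

_≟ₗ_ : DecidableEquality (List ℕ)
_≟ₗ_ = ≡-dec _≟_

open DecMembership _≟ₗ_ using (_∈?_)

isNonCylKing? : ∀ n → Decidable (λ σ → IsKing n σ × ¬ WrapAdj σ)
isNonCylKing? n σ = isKing? n σ ×-dec ¬? (wrapAdj? σ)

nonCylKings : ℕ → List (List ℕ)
nonCylKings n = filter (isNonCylKing? n) (words n n)

#B : ℕ → ℕ
#B n = length (nonCylKings n)

#K≡#CK+#B : ∀ n → #K n ≡ #CK n + #B n
#K≡#CK+#B n = count-× (isKing? n) wrapAdj? (words n n)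

∈-nonCylKings⁻ : ∀ {n σ} → σ ∈ nonCylKings n → IsKing n σ × ¬ WrapAdj σ
∈-nonCylKings⁻ {n} = proj₂ ∘ ∈-filter⁻ (isNonCylKing? n) {xs = words n n}

nonCylKings-unique : ∀ n → Unique (nonCylKings n)
nonCylKings-unique n = Unique.filter⁺ (isNonCylKing? n) (words-unique n n)

origins : List ℕ → List (List ℕ)
origins τ with last τ
... | nothing = []
... | just y  = map (λ x → x ∷ remove _≟_ x τ) (neighbours y)

length-origins : ∀ τ → length (origins τ) ≤ 2
length-origins τ with last τ
... | nothing = z≤n
... | just _  = ≤-refl

last-∷ : ∀ (a : ℕ) l → ∃ λ y → last (a ∷ l) ≡ just y × y ∈ a ∷ l
last-∷ a []      = a , refl , here refl
last-∷ a (b ∷ l) with y , eq , y∈ ← last-∷ b l = y , eq , there y∈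

¬WrapAdj⇒Near : ∀ {x y} (a : ℕ) l → last (a ∷ l) ≡ just y → ¬ WrapAdj (x ∷ a ∷ l) → Near x y
¬WrapAdj⇒Near a l eq ¬wrap with last (a ∷ l)
¬WrapAdj⇒Near a l refl ¬wrap | just _ = ¬wrap

origins-last : ∀ τ {y} → last τ ≡ just y →
               origins τ ≡ map (λ x → x ∷ remove _≟_ x τ) (neighbours y)
origins-last τ eq with last τ
origins-last τ refl | just _ = refl

∈-origins : ∀ {x ρ τ} → x ∉ ρ → ¬ WrapAdj (x ∷ ρ) → Insertion x ρ τ → x ∷ ρ ∈ origins τ
∈-origins {ρ = []} _ _ ()
∈-origins {x} {a ∷ l} {τ} x∉ρ ¬wrap i with y , last≡y , y∈ρ ← last-∷ a l =
  subst₂ (λ ρ′ τs → x ∷ ρ′ ∈ τs)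
         (trans (Insertion-remove _≟_ i) (remove-∉ _≟_ (a ∷ l) x∉ρ))
         (sym (origins-last τ (trans (Insertion-last i) last≡y)))
         (∈-map⁺ (λ z → z ∷ remove _≟_ z τ) x∈neighbours)
  where
  x∈neighbours : x ∈ neighbours y
  x∈neighbours = Near⇒∈neighbours x y (¬WrapAdj⇒Near a l last≡y ¬wrap) (λ { refl → x∉ρ y∈ρ })

-- Double counting

extended : ℕ → List (List ℕ)
extended n = concatMap extensions (nonCylKings n)

kings : ℕ → List (List ℕ)
kings n = filter (isKing? n) (words n n)

#B*[n∸6]≤length-extended : ∀ n → #B n * (n ∸ 6) ≤ length (extended n)
#B*[n∸6]≤length-extended n = length-concatMap-≥ extensions (n ∸ 6) (nonCylKings n) enough
  where
  enough : ∀ {σ} → σ ∈ nonCylKings n → n ∸ 6 ≤ length (extensions σ)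
  enough {[]}    σ∈ with ((refl , _) , _) , _ ← ∈-nonCylKings⁻ {n} σ∈ = z≤n
  enough {x ∷ ρ} σ∈ with (perm , king) , _ ← ∈-nonCylKings⁻ {n} σ∈ =
    length-extensions perm (KingAdj-tail king)

multiplicity-extended : ∀ n τ → count (τ ≟ₗ_) (extended n) ≤ 2
multiplicity-extended n τ = begin
  count (τ ≟ₗ_) (extended n)
    ≤⟨ count-concatMap-≤ (τ ≟ₗ_) (_∈? origins τ) extensions (nonCylKings n) once from-origin ⟩
  count (_∈? origins τ) (nonCylKings n)
    ≤⟨ Unique⇒length≤ _≟ₗ_ (origins τ) (Unique.filter⁺ (_∈? origins τ) (nonCylKings-unique n))
                                        (proj₂ ∘ ∈-filter⁻ (_∈? origins τ) {xs = nonCylKings n}) ⟩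
  length (origins τ)
    ≤⟨ length-origins τ ⟩
  2 ∎
  where
  open ≤-Reasoning
  once : ∀ {σ} → σ ∈ nonCylKings n → count (τ ≟ₗ_) (extensions σ) ≤ 1
  once {[]}    _  = z≤n
  once {x ∷ ρ} σ∈ with ((_ , _ , x∉ρ ∷ _) , _) , _ ← ∈-nonCylKings⁻ {n} σ∈ =
    count-Unique _≟ₗ_ τ (Unique.filter⁺ kingAdj? (gaps-unique _≟_ x ρ (All¬⇒¬Any x∉ρ)))
  from-origin : ∀ {σ τ′} → σ ∈ nonCylKings n → τ′ ∈ extensions σ → τ ≡ τ′ → σ ∈ origins τ
  from-origin {[]}    _  ()
  from-origin {x ∷ ρ} σ∈ τ∈ refl with ((_ , _ , x∉ρ ∷ _) , _) , ¬wrap ← ∈-nonCylKings⁻ {n} σ∈ =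
    ∈-origins (All¬⇒¬Any x∉ρ) ¬wrap (∈-gaps⇒Insertion ρ (proj₁ (∈-filter⁻ kingAdj? τ∈)))

length-extended≤2*#K : ∀ n → length (extended n) ≤ 2 * #K n
length-extended≤2*#K n =
  length-≤-*-length _≟ₗ_ 2 (extended n) (kings n) extended⊆kings (multiplicity-extended n)
  where
  extended⊆kings : ∀ {τ} → τ ∈ extended n → τ ∈ kings n
  extended⊆kings τ∈ with σ , σ∈ , τ∈σ ← find (∈-concatMap⁻ extensions {xs = nonCylKings n} τ∈) =
    ∈-filter⁺ (isKing? n) (IsPerm⇒∈words (proj₁ king)) king
    where king = ∈-extensions⇒IsKing (proj₁ (proj₁ (∈-nonCylKings⁻ σ∈))) τ∈σ

#B*[n∸6]≤2*#K : ∀ n → #B n * (n ∸ 6) ≤ 2 * #K n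
#B*[n∸6]≤2*#K n = ≤-trans (#B*[n∸6]≤length-extended n) (length-extended≤2*#K n)

nonempty⇒∃∈ : ∀ {xs : List A} → 0 ℕ.< length xs → ∃ λ x → x ∈ xs
nonempty⇒∃∈ {xs = x ∷ _} _ = x , here refl

∃King : ∀ k → ∃ (IsKing (6 + k))
∃King zero    = _ , toWitness {a? = isKing? 6 (2 ∷ 4 ∷ 6 ∷ 1 ∷ 3 ∷ 5 ∷ [])} tt
∃King (suc k) with τ , perm , king ← ∃King k
              with τ′ , τ′∈ ← nonempty⇒∃∈ (≤-trans (s≤s z≤n) (length-extensions (IsPerm-∷-suc perm) king)) =
  τ′ , ∈-extensions⇒IsKing (IsPerm-∷-suc perm) τ′∈

#K>0 : ∀ n → 6 ≤ n → 0 ℕ.< #K n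
#K>0 n 6≤n with τ , king ← ∃King (n ∸ 6) rewrite m+[n∸m]≡n 6≤n =
  filter-some (isKing? n) (lose (IsPerm⇒∈words (proj₁ king)) king)

-- The rational estimate

b*[1+2d]≤2k⇒b*d<k : ∀ b d k → 0 ℕ.< k → b * suc (2 * d) ≤ 2 * k → b * d ℕ.< k
b*[1+2d]≤2k⇒b*d<k zero      d k k>0 _ = k>0
b*[1+2d]≤2k⇒b*d<k b@(suc _) d k _   h = *-cancelˡ-< 2 (b * d) k (begin-strict
  2 * (b * d)      ≡⟨ x∙yz≈y∙xz 2 b d ⟩
  b * (2 * d)      <⟨ *-monoʳ-< b (n<1+n (2 * d)) ⟩
  b * suc (2 * d)  ≤⟨ h ⟩
  2 * k            ∎)
  where open ≤-Reasoning

#B*[1+d]<#K : ∀ n d → 7 + 2 * suc d ≤ n → #B n * suc d ℕ.< #K n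
#B*[1+d]<#K n d N≤n =
  b*[1+2d]≤2k⇒b*d<k (#B n) (suc d) (#K n) (#K>0 n (≤-trans (m≤m+n 6 _) N≤n))
                    (≤-trans (*-monoʳ-≤ (#B n) (∸-monoˡ-≤ 6 N≤n)) (#B*[n∸6]≤2*#K n))

∣c/[1+k]-1∣≃b/[1+k] : ∀ c b k → c + b ≡ suc k →
                      ℚᵘ.∣ mkℚᵘ (ℤ.+ c) k ℚᵘ.- ℚᵘ.1ℚᵘ ∣ ℚᵘ.≃ mkℚᵘ (ℤ.+ b) k
∣c/[1+k]-1∣≃b/[1+k] c b k c+b≡k =
  *≡* (cong₂ ℤ._*_ (cong ℤ.+_ ∣num∣≡b) (cong (λ m → ℤ.+ suc m) (sym (*-identityʳ k))))
  where
  open ℤ-Solver.+-*-Solver using (solve; _:+_; _:*_; _:=_; :-_; con)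
  num : ℤ.ℤ → ℤ.ℤ
  num m = ℤ.+ c ℤ.* ℤ.+ 1 ℤ.+ ℤ.- ℤ.+ 1 ℤ.* m
  cancel : ∀ c b → c ℤ.* ℤ.+ 1 ℤ.+ ℤ.- ℤ.+ 1 ℤ.* (c ℤ.+ b) ≡ ℤ.- b
  cancel = solve 2 (λ c b → c :* con (ℤ.+ 1) :+ (:- con (ℤ.+ 1)) :* (c :+ b) := :- b) refl
  ∣num∣≡b : ℤ.∣ num (ℤ.+ suc k) ∣ ≡ b
  ∣num∣≡b = begin
    ℤ.∣ num (ℤ.+ suc k) ∣       ≡⟨ cong (ℤ.∣_∣ ∘ num) (trans (cong ℤ.+_ (sym c+b≡k)) (ℤ.pos-+ c b)) ⟩
    ℤ.∣ num (ℤ.+ c ℤ.+ ℤ.+ b) ∣ ≡⟨ cong ℤ.∣_∣ (cancel (ℤ.+ c) (ℤ.+ b)) ⟩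
    ℤ.∣ ℤ.- ℤ.+ b ∣             ≡⟨ ℤ.∣-i∣≡∣i∣ (ℤ.+ b) ⟩
    b                           ∎
    where open ≡-Reasoning

∣c/[1+k]-1∣<ε : ∀ c b k e d .(cop : Coprime (suc e) (suc d)) →
                c + b ≡ suc k → b * suc d ℕ.< suc e * suc k →
                ∣ ℤ.+ c ℚ./ suc k - 1ℚ ∣ < mkℚ ℤ.+[1+ e ] d cop
∣c/[1+k]-1∣<ε c b k e d cop c+b≡k lt =
  ℚ.toℚᵘ-cancel-< (ℚᵘ.<-respˡ-≃ (ℚᵘ.≃-sym toℚᵘ≃b/k) b/k<ε)
  where
  toℚᵘ≃b/k : toℚᵘ ∣ ℤ.+ c ℚ./ suc k - 1ℚ ∣ ℚᵘ.≃ mkℚᵘ (ℤ.+ b) k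
  toℚᵘ≃b/k = begin
    toℚᵘ ∣ c/k - 1ℚ ∣                          ≈⟨ ℚ.toℚᵘ-homo-∣-∣ (c/k - 1ℚ) ⟩
    ℚᵘ.∣ toℚᵘ (c/k - 1ℚ) ∣                     ≈⟨ ℚᵘ.∣-∣-cong (ℚ.toℚᵘ-homo-+ c/k (ℚ.- 1ℚ)) ⟩
    ℚᵘ.∣ toℚᵘ c/k ℚᵘ.+ toℚᵘ (ℚ.- 1ℚ) ∣         ≈⟨ ℚᵘ.∣-∣-cong (ℚᵘ.+-cong (ℚ.toℚᵘ-fromℚᵘ (mkℚᵘ (ℤ.+ c) k))
                                                                          (ℚ.toℚᵘ-homo‿- 1ℚ)) ⟩
    ℚᵘ.∣ mkℚᵘ (ℤ.+ c) k ℚᵘ.- ℚᵘ.1ℚᵘ ∣          ≈⟨ ∣c/[1+k]-1∣≃b/[1+k] c b k c+b≡k ⟩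
    mkℚᵘ (ℤ.+ b) k                             ∎
    where
    open ℚᵘ.≃-Reasoning
    c/k = ℤ.+ c ℚ./ suc k
  b/k<ε : mkℚᵘ (ℤ.+ b) k ℚᵘ.< mkℚᵘ ℤ.+[1+ e ] d
  b/k<ε = *<* (subst₂ ℤ._<_ (ℤ.pos-* b (suc d)) (ℤ.pos-* (suc e) (suc k)) (ℤ.+<+ lt))

ratio-close : ∀ n e d .(cop : Coprime (suc e) (suc d)) →
              0 ℕ.< #K n → #B n * suc d ℕ.< suc e * #K n →
              ∣ ratio n - 1ℚ ∣ < mkℚ ℤ.+[1+ e ] d cop
ratio-close n e d cop K>0 lt with #K n | #K≡#CK+#B n
ratio-close n e d cop () lt | zero  | _
ratio-close n e d cop _  lt | suc k | K≡CK+B = ∣c/[1+k]-1∣<ε (#CK n) (#B n) k e d cop (sym K≡CK+B) lt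

theorem3p2 : ∀ (ε : ℚ) → 0ℚ < ε → ∃[ N ] (∀ (n : ℕ) → N ≤ n → ∣ ratio n - 1ℚ ∣ < ε)
theorem3p2 (mkℚ (ℤ.+ zero)  d cop) (ℚ.*<* (ℤ.+<+ ()))
theorem3p2 (mkℚ ℤ.-[1+ _ ]  d cop) (ℚ.*<* ())
-- For ε = (1 + e) / (1 + d) and n ≥ N, #B n (n ∸ 6) ≤ 2 #K n gives #B n / #K n < 1 / (1 + d).
theorem3p2 (mkℚ ℤ.+[1+ e ]  d cop) _ = 7 + 2 * suc d , close
  where
  close : ∀ n → 7 + 2 * suc d ≤ n → ∣ ratio n - 1ℚ ∣ < mkℚ ℤ.+[1+ e ] d cop
  close n N≤n = ratio-close n e d cop K>0 (≤-trans (#B*[1+d]<#K n d N≤n) (m≤n*m (#K n) (suc e)))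
    where K>0 = #K>0 n (≤-trans (m≤m+n 6 _) N≤n)
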